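{- Let $G$ be a graph with exactly three vertices. Then $\Gamma(G)\cong\mathbb{Z}_2^{|E(G)|-2}$ if $G$ is connected, $\Gamma(G)\cong\mathbb{Z}_2^{|E(G)|-1}$ if $G$ is disconnected with at least one edge, and $\Gamma(G)$ is trivial if $|E(G)|=0$.
   Context: Graphs are finite, multiple edges allowed, no loops; $E(v)$ is the set of edges incident to $v$. $\Gamma(G)$ is the group generated by $\{x_e:e\in E(G)\}$ with relations $x_e^2=1$ for all $e$, $[x_e,x_{e'}]=1$ whenever $e,e'\in E(v)$ for some vertex $v$, and $\prod_{e\in E(v)}x_e=1$ for each vertex $v$. -}

module Defs where

open import Data.Nat using (ℕ; _∸_; _≥_)
open import Data.Fin using (Fin)
open import Data.Fin.Properties using (_≟_)
open import Data.Bool using (Bool; _xor_)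
open import Data.Vec using (Vec; zipWith)
open import Data.List using (List; filter; foldr; allFin)
open import Data.Sum using (_⊎_)
open import Data.Product using (_×_; ∃)
open import Relation.Nullary using (¬_; Dec)
open import Relation.Nullary.Decidable using (_⊎-dec_)
open import Relation.Binary.PropositionalEquality using (_≡_; _≢_)

record Graph3 : Set where
  field
    m    : ℕ
    src  : Fin m → Fin 3
    tgt  : Fin m → Fin 3
    noLoop : ∀ e → src e ≢ tgt e
open Graph3 public

Incident : (G : Graph3) → Fin (m G) → Fin 3 → Set
Incident G e v = (src G e ≡ v) ⊎ (tgt G e ≡ v)

incident? : (G : Graph3) → (v : Fin 3) → (e : Fin (m G)) → Dec (Incident G e v)
incident? G v e = (src G e ≟ v) ⊎-dec (tgt G e ≟ v)

Ev : (G : Graph3) → Fin 3 → List (Fin (m G))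
Ev G v = filter (incident? G v) (allFin (m G))

data Reach (G : Graph3) : Fin 3 → Fin 3 → Set where
  here : ∀ {u} → Reach G u u
  step : ∀ {u w} (e : Fin (m G)) → Incident G e u → Incident G e w →
         ∀ {v} → Reach G w v → Reach G u v

Connected : Graph3 → Set
Connected G = ∀ u v → Reach G u v

data Word (n : ℕ) : Set where
  gen  : Fin n → Word n
  one  : Word n
  _·_  : Word n → Word n → Word n
  inv  : Word n → Word n

prod : ∀ {n} → List (Fin n) → Word n
prod = foldr (λ e w → gen e · w) one

-- The congruence on words defining Γ(G) = ⟨ x_e (e ∈ E(G)) | relations ⟩:
-- the smallest congruence containing the group axioms and the defining relations.
data Rel (G : Graph3) : Word (m G) → Word (m G) → Set where
  refl′  : ∀ {a} → Rel G a a
  sym′   : ∀ {a b} → Rel G a b → Rel G b a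
  trans′ : ∀ {a b c} → Rel G a b → Rel G b c → Rel G a c
  ·-cong   : ∀ {a b c d} → Rel G a b → Rel G c d → Rel G (a · c) (b · d)
  inv-cong : ∀ {a b} → Rel G a b → Rel G (inv a) (inv b)
  assoc  : ∀ a b c → Rel G ((a · b) · c) (a · (b · c))
  idˡ    : ∀ a → Rel G (one · a) a
  idʳ    : ∀ a → Rel G (a · one) a
  invˡ   : ∀ a → Rel G (inv a · a) one
  invʳ   : ∀ a → Rel G (a · inv a) one
  sq     : ∀ e → Rel G (gen e · gen e) one
  comm   : ∀ e e′ v → Incident G e v → Incident G e′ v →
           Rel G (gen e · gen e′) (gen e′ · gen e)
  vertex : ∀ v → Rel G (prod (Ev G v)) one

_⊕_ : ∀ {k} → Vec Bool k → Vec Bool k → Vec Bool k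
_⊕_ = zipWith _xor_

record Iso (G : Graph3) (k : ℕ) : Set where
  field
    φ         : Word (m G) → Vec Bool k
    φ-cong    : ∀ {a b} → Rel G a b → φ a ≡ φ b
    φ-hom     : ∀ a b → φ (a · b) ≡ φ a ⊕ φ b
    φ-inj     : ∀ a b → φ a ≡ φ b → Rel G a b
    φ-surj    : ∀ y → ∃ λ a → φ a ≡ y

Trivial : Graph3 → Set
Trivial G = ∀ a → Rel G a one

module Submission where

-- Each edge of a loopless graph on three vertices misses exactly one of them (miss), so any
-- two edges share a vertex. Hence the generators of Γ(G) commute, every element squares to
-- one, and a word is determined up to the relations by its parity vector in 𝔽₂^E modulo
-- the span of the vertex vectors χ v (the indicator vectors of E(v)), which sum to zero.
-- If G is connected, two edges miss different vertices a ≠ b; they are pivot coordinates for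
-- χ b and χ a, which then span every χ v, and eliminating both pivots identifies Γ(G) with
-- 𝔽₂^(|E|-2). If G is disconnected, all edges miss one vertex x, so χ x = 0 while the other
-- two vertex vectors are all-ones, and a single elimination gives 𝔽₂^(|E|-1).

open import Defs
open import Level using (0ℓ)
open import Algebra.Bundles using (CommutativeRing; Group; AbelianGroup)
open import Algebra.Structures using (IsGroup)
open import Data.Nat using (ℕ; zero; suc; _∸_; _≥_)
open import Data.Fin using (Fin; zero; suc; punchIn; punchOut)
open import Data.Fin.Properties
  using (_≟_; all?; any?; ¬∀⟶∃¬; punchIn-injective; punchInᵢ≢i; punchIn-punchOut)
open import Data.Bool using (Bool; true; false; not; _∧_; _xor_; if_then_else_)
import Data.Bool.Properties as Bool
open import Data.Bool.Properties
  using (xor-same; xor-assoc; xor-comm; xor-identityʳ; ∧-identityʳ; ∧-zeroʳ; ∧-distribʳ-xor)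
open import Data.Product using (_×_; _,_; proj₁; proj₂; ∃; ∃₂)
open import Data.Sum using (_⊎_)
open import Data.Empty using (⊥-elim)
open import Data.List using (filter; tabulate)
open import Data.Vec as Vec using (Vec; lookup)
open import Data.Vec.Properties using (tabulate-cong; lookup∘tabulate; tabulate∘lookup)
open import Function using (_∘_; id; _⇔_; mk⇔; Equivalence)
open import Relation.Nullary using (¬_; yes; no; does; ¬?)
open import Relation.Nullary.Decidable
  using (from-yes; _×-dec_; _⊎-dec_; _→-dec_; dec-true; dec-false; does-⇔; decidable-stable)
open import Relation.Unary using (Decidable)
open import Relation.Binary.PropositionalEquality
  using (_≡_; _≢_; _≗_; refl; sym; trans; cong; cong₂; subst; module ≡-Reasoning)

avoid-exists : ∀ (x y : Fin 3) → ∃ λ z → z ≢ x × z ≢ y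
avoid-exists = from-yes
  (all? λ (x : Fin 3) → all? λ (y : Fin 3) → any? λ (z : Fin 3) → ¬? (z ≟ x) ×-dec ¬? (z ≟ y))

avoid : Fin 3 → Fin 3 → Fin 3
avoid x y = proj₁ (avoid-exists x y)

avoid-≢ˡ : ∀ x y → avoid x y ≢ x
avoid-≢ˡ x y = proj₁ (proj₂ (avoid-exists x y))

avoid-≢ʳ : ∀ x y → avoid x y ≢ y
avoid-≢ʳ x y = proj₂ (proj₂ (avoid-exists x y))

∈-pair⇔≢avoid : ∀ (s t v : Fin 3) → s ≢ t → (s ≡ v ⊎ t ≡ v) ⇔ v ≢ avoid s t
∈-pair⇔≢avoid s t v s≢t = mk⇔ (proj₁ (both s t v s≢t)) (proj₂ (both s t v s≢t))
  where
  both : ∀ (s t v : Fin 3) → s ≢ t →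
         (s ≡ v ⊎ t ≡ v → v ≢ avoid s t) × (v ≢ avoid s t → s ≡ v ⊎ t ≡ v)
  both = from-yes
    (all? λ (s : Fin 3) → all? λ (t : Fin 3) → all? λ (v : Fin 3) → ¬? (s ≟ t) →-dec
      (((s ≟ v) ⊎-dec (t ≟ v)) →-dec ¬? (v ≟ avoid s t)) ×-dec
      (¬? (v ≟ avoid s t) →-dec ((s ≟ v) ⊎-dec (t ≟ v))))

-- w equals exactly one of the three distinct vertices x, y, v.
≢-third : ∀ (x y v w : Fin 3) → x ≢ y → v ≢ x → v ≢ y →
          not (does (v ≟ w)) ≡ not (does (x ≟ w)) xor not (does (y ≟ w))
≢-third = from-yes
  (all? λ (x : Fin 3) → all? λ (y : Fin 3) → all? λ (v : Fin 3) → all? λ (w : Fin 3) →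
    ¬? (x ≟ y) →-dec ¬? (v ≟ x) →-dec ¬? (v ≟ y) →-dec
    (not (does (v ≟ w)) Bool.≟ not (does (x ≟ w)) xor not (does (y ≟ w))))

module _ {G : Graph3} where

  Reach-trans : ∀ {u v w} → Reach G u v → Reach G v w → Reach G u w
  Reach-trans here         q = q
  Reach-trans (step e i j p) q = step e i j (Reach-trans p q)

  Reach-sym : ∀ {u v} → Reach G u v → Reach G v u
  Reach-sym here           = here
  Reach-sym (step e i j p) = Reach-trans (Reach-sym p) (step e j i here)

BV : ℕ → Set
BV n = Fin n → Bool

module _ {n : ℕ} where

  infixr 6 _⊻_
  infixr 7 _⊙_

  0ᵛ : BV n
  0ᵛ _ = false

  _⊻_ : BV n → BV n → BV n
  (z ⊻ w) i = z i xor w i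

  _⊙_ : Bool → BV n → BV n
  (α ⊙ z) i = α ∧ z i

  δ : Fin n → BV n
  δ i j = does (i ≟ j)

  Span : BV n → BV n → BV n → Set
  Span u₁ u₂ z = ∃₂ λ α β → z ≗ α ⊙ u₁ ⊻ β ⊙ u₂

⨁ : ∀ {k} → BV k → Bool
⨁ {zero}  z = false
⨁ {suc k} z = z zero xor ⨁ (z ∘ suc)

∑ : ∀ {k n} → (Fin k → BV n) → BV n
∑ v j = ⨁ (λ i → v i j)

⨁-cong : ∀ {k} {z w : BV k} → z ≗ w → ⨁ z ≡ ⨁ w
⨁-cong {zero}  eq = refl
⨁-cong {suc k} eq = cong₂ _xor_ (eq zero) (⨁-cong (eq ∘ suc))

⨁-0ᵛ : ∀ {k} → ⨁ {k} 0ᵛ ≡ false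
⨁-0ᵛ {zero}  = refl
⨁-0ᵛ {suc k} = ⨁-0ᵛ {k}

∑-basis : ∀ {n} (z : BV n) → ∑ (λ i → z i ⊙ δ i) ≗ z
∑-basis {suc n} z zero =
  trans (cong₂ _xor_ (∧-identityʳ (z zero)) (trans (⨁-cong (λ i → ∧-zeroʳ (z (suc i)))) (⨁-0ᵛ {n})))
        (xor-identityʳ (z zero))
∑-basis {suc n} z (suc j) =
  trans (cong (_xor ⨁ (λ i → z (suc i) ∧ δ i j)) (∧-zeroʳ (z zero))) (∑-basis (z ∘ suc) j)

xor-cancelʳ : ∀ {x y w} → x xor y ≡ w → x ≡ w xor y
xor-cancelʳ {x} {y} refl =
  sym (trans (xor-assoc x y y) (trans (cong (x xor_) (xor-same y)) (xor-identityʳ x)))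

xor-interchange : ∀ a b c d → (a xor b) xor (c xor d) ≡ (a xor c) xor (b xor d)
xor-interchange = interchange
  where open import Algebra.Properties.CommutativeSemigroup
          (CommutativeRing.+-commutativeSemigroup Bool.xor-∧-commutativeRing)

record IsLinear {m k} (L : BV m → BV k) : Set where
  field
    ≗-cong : ∀ {z w} → z ≗ w → L z ≗ L w
    ⊻-hom  : ∀ z w → L (z ⊻ w) ≗ L z ⊻ L w

  0ᵛ-hom : L 0ᵛ ≗ 0ᵛ
  0ᵛ-hom j = trans (⊻-hom 0ᵛ 0ᵛ j) (xor-same (L 0ᵛ j))

  ⊙-hom : ∀ α z → L (α ⊙ z) ≗ α ⊙ L z
  ⊙-hom true  z j = refl
  ⊙-hom false z j = 0ᵛ-hom j

  ∑-hom : ∀ {l} (v : Fin l → BV m) → L (∑ v) ≗ ∑ (L ∘ v)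
  ∑-hom {zero}  v j = 0ᵛ-hom j
  ∑-hom {suc l} v j =
    trans (⊻-hom (v zero) (∑ (v ∘ suc)) j) (cong (L (v zero) j xor_) (∑-hom (v ∘ suc) j))

  ⊙-kill : ∀ α {u} → L u ≗ 0ᵛ → L (α ⊙ u) ≗ 0ᵛ
  ⊙-kill α {u} Lu j = trans (⊙-hom α u j) (trans (cong (α ∧_) (Lu j)) (∧-zeroʳ α))

  Span⊆ker : ∀ {u₁ u₂ z} → L u₁ ≗ 0ᵛ → L u₂ ≗ 0ᵛ → Span u₁ u₂ z → L z ≗ 0ᵛ
  Span⊆ker {u₁} {u₂} {z} Lu₁ Lu₂ (α , β , z≗) j = begin
    L z j                                     ≡⟨ ≗-cong z≗ j ⟩
    L (α ⊙ u₁ ⊻ β ⊙ u₂) j                     ≡⟨ ⊻-hom (α ⊙ u₁) (β ⊙ u₂) j ⟩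
    L (α ⊙ u₁) j xor L (β ⊙ u₂) j             ≡⟨ cong₂ _xor_ (⊙-kill α Lu₁ j) (⊙-kill β Lu₂ j) ⟩
    false                                     ∎
    where open ≡-Reasoning

IsLinear-∘ : ∀ {m k l} {L : BV m → BV k} {K : BV k → BV l} →
             IsLinear K → IsLinear L → IsLinear (K ∘ L)
IsLinear-∘ {L = L} {K} linK linL = record
  { ≗-cong = λ eq → K.≗-cong (L.≗-cong eq)
  ; ⊻-hom  = λ z w j → trans (K.≗-cong (L.⊻-hom z w) j) (K.⊻-hom (L z) (L w) j)
  }
  where
  module K = IsLinear linK
  module L = IsLinear linL

-- For u p ≡ true, eliminate is the quotient map 𝔽₂^(n+1) → 𝔽₂^(n+1)/⟨u⟩ ≅ 𝔽₂^n:
-- subtract the multiple of u that clears coordinate p, then drop that coordinate.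
module Pivot {n} (p : Fin (suc n)) (u : BV (suc n)) where

  eliminate : BV (suc n) → BV n
  eliminate z = (z ⊻ z p ⊙ u) ∘ punchIn p

  eliminate-linear : IsLinear eliminate
  eliminate-linear = record
    { ≗-cong = λ {z} {w} eq j → cong₂ _xor_ (eq (punchIn p j)) (cong (_∧ u (punchIn p j)) (eq p))
    ; ⊻-hom  = λ z w j → let q = punchIn p j in
        trans (cong ((z q xor w q) xor_) (∧-distribʳ-xor (u q) (z p) (w p)))
              (xor-interchange (z q) (w q) (z p ∧ u q) (w p ∧ u q))
    }

  eliminate-δ : ∀ i → eliminate (δ (punchIn p i)) ≗ δ i
  eliminate-δ i j = trans
    (cong₂ _xor_ (does-⇔ (mk⇔ (punchIn-injective p i j) (cong (punchIn p)))
                         (punchIn p i ≟ punchIn p j) (i ≟ j))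
                 (cong (_∧ u (punchIn p j)) (dec-false (punchIn p i ≟ p) (punchInᵢ≢i p i))))
    (xor-identityʳ (δ i j))

  module _ (pivot : u p ≡ true) where

    eliminate-u : eliminate u ≗ 0ᵛ
    eliminate-u j rewrite pivot = xor-same (u (punchIn p j))

    eliminate-ker : ∀ z → eliminate z ≗ 0ᵛ → z ≗ z p ⊙ u
    eliminate-ker z Lz≗0 q with p ≟ q
    ... | yes refl = sym (trans (cong (z p ∧_) pivot) (∧-identityʳ (z p)))
    ... | no p≢q   = subst (λ r → z r ≡ (z p ⊙ u) r) (punchIn-punchOut p≢q)
                           (xor-cancelʳ (Lz≗0 (punchOut p≢q)))

module Pivot₂ {n} (p₁ : Fin (suc (suc n))) (p₂ : Fin (suc n)) (u₁ u₂ : BV (suc (suc n))) where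

  private
    module E₁ = Pivot p₁ u₁
    module E₂ = Pivot p₂ (E₁.eliminate u₂)
    module L₁ = IsLinear E₁.eliminate-linear
    module L₂ = IsLinear E₂.eliminate-linear

  eliminate₂ : BV (suc (suc n)) → BV n
  eliminate₂ = E₂.eliminate ∘ E₁.eliminate

  eliminate₂-linear : IsLinear eliminate₂
  eliminate₂-linear = IsLinear-∘ E₂.eliminate-linear E₁.eliminate-linear

  eliminate₂-δ : ∀ i → eliminate₂ (δ (punchIn p₁ (punchIn p₂ i))) ≗ δ i
  eliminate₂-δ i j = trans (L₂.≗-cong (E₁.eliminate-δ (punchIn p₂ i)) j) (E₂.eliminate-δ i j)

  module _ (pivot₁ : u₁ p₁ ≡ true) (pivot₂ : E₁.eliminate u₂ p₂ ≡ true) where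

    Span⊆ker : ∀ {z} → Span u₁ u₂ z → eliminate₂ z ≗ 0ᵛ
    Span⊆ker = IsLinear.Span⊆ker eliminate₂-linear
      (λ j → trans (L₂.≗-cong (E₁.eliminate-u pivot₁) j) (L₂.0ᵛ-hom j))
      (E₂.eliminate-u pivot₂)

    ker⊆Span : ∀ z → eliminate₂ z ≗ 0ᵛ → Span u₁ u₂ z
    ker⊆Span z Lz≗0 = d , c , λ i → xor-cancelʳ (z′≗ i)
      where
      c : Bool
      c = E₁.eliminate z p₂
      L₁z≗ : E₁.eliminate z ≗ c ⊙ E₁.eliminate u₂
      L₁z≗ = E₂.eliminate-ker pivot₂ (E₁.eliminate z) Lz≗0
      L₁z′≗0 : E₁.eliminate (z ⊻ c ⊙ u₂) ≗ 0ᵛ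
      L₁z′≗0 j = trans (L₁.⊻-hom z (c ⊙ u₂) j)
                   (trans (cong₂ _xor_ (L₁z≗ j) (L₁.⊙-hom c u₂ j))
                          (xor-same (c ∧ E₁.eliminate u₂ j)))
      d : Bool
      d = (z ⊻ c ⊙ u₂) p₁
      z′≗ : z ⊻ c ⊙ u₂ ≗ d ⊙ u₁
      z′≗ = E₁.eliminate-ker pivot₁ (z ⊻ c ⊙ u₂) L₁z′≗0

tabulate-xor : ∀ {k} (z w : BV k) → Vec.tabulate (z ⊻ w) ≡ Vec.tabulate z ⊕ Vec.tabulate w
tabulate-xor {zero}  z w = refl
tabulate-xor {suc k} z w = cong ((z zero xor w zero) Vec.∷_) (tabulate-xor (z ∘ suc) (w ∘ suc))

module _ {c ℓ} (𝒢 : Group c ℓ) where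
  open Group 𝒢 renaming (assoc to ∙-assoc)
  open import Relation.Binary.Reasoning.Setoid setoid

  commute-⁻¹ : ∀ {x y} → x ∙ y ≈ y ∙ x → x ∙ y ⁻¹ ≈ y ⁻¹ ∙ x
  commute-⁻¹ {x} {y} xy≈yx = begin
    x ∙ y ⁻¹                ≈⟨ identityˡ (x ∙ y ⁻¹) ⟨
    ε ∙ (x ∙ y ⁻¹)          ≈⟨ ∙-congʳ (inverseˡ y) ⟨
    (y ⁻¹ ∙ y) ∙ (x ∙ y ⁻¹) ≈⟨ ∙-assoc (y ⁻¹) y (x ∙ y ⁻¹) ⟩
    y ⁻¹ ∙ (y ∙ (x ∙ y ⁻¹)) ≈⟨ ∙-congˡ (∙-assoc y x (y ⁻¹)) ⟨
    y ⁻¹ ∙ ((y ∙ x) ∙ y ⁻¹) ≈⟨ ∙-congˡ (∙-congʳ xy≈yx) ⟨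
    y ⁻¹ ∙ ((x ∙ y) ∙ y ⁻¹) ≈⟨ ∙-congˡ (∙-assoc x y (y ⁻¹)) ⟩
    y ⁻¹ ∙ (x ∙ (y ∙ y ⁻¹)) ≈⟨ ∙-congˡ (∙-congˡ (inverseʳ y)) ⟩
    y ⁻¹ ∙ (x ∙ ε)          ≈⟨ ∙-congˡ (identityʳ x) ⟩
    y ⁻¹ ∙ x                ∎

module _ (G : Graph3) where

  miss : Fin (m G) → Fin 3
  miss e = avoid (src G e) (tgt G e)

  incident⇔≢miss : ∀ {e v} → Incident G e v ⇔ v ≢ miss e
  incident⇔≢miss {e} {v} = ∈-pair⇔≢avoid (src G e) (tgt G e) v (noLoop G e)

  ≢miss⇒incident : ∀ {e v} → v ≢ miss e → Incident G e v
  ≢miss⇒incident = Equivalence.from incident⇔≢miss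

  χ : Fin 3 → BV (m G)
  χ v e = does (incident? G v e)

  χ-miss : ∀ v e → χ v e ≡ not (does (v ≟ miss e))
  χ-miss v e = does-⇔ incident⇔≢miss (incident? G v e) (¬? (v ≟ miss e))

  χ-at-miss : ∀ e → χ (miss e) e ≡ false
  χ-at-miss e = dec-false (incident? G (miss e) e) (λ i → Equivalence.to incident⇔≢miss i refl)

  χ-at-≢miss : ∀ {v e} → v ≢ miss e → χ v e ≡ true
  χ-at-≢miss {v} {e} v≢ = dec-true (incident? G v e) (≢miss⇒incident v≢)

  χ-Span : ∀ {a b} → a ≢ b → ∀ v → Span (χ a) (χ b) (χ v)
  χ-Span {a} {b} a≢b v with v ≟ a | v ≟ b
  ... | yes refl | _        = true , false , λ e → sym (xor-identityʳ (χ v e))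
  ... | no _     | yes refl = false , true , λ e → refl
  ... | no v≢a   | no v≢b   = true , true , λ e → begin
    χ v e                                               ≡⟨ χ-miss v e ⟩
    not (does (v ≟ miss e))                             ≡⟨ ≢-third a b v (miss e) a≢b v≢a v≢b ⟩
    not (does (a ≟ miss e)) xor not (does (b ≟ miss e)) ≡⟨ cong₂ _xor_ (χ-miss a e) (χ-miss b e) ⟨
    χ a e xor χ b e                                     ∎
    where open ≡-Reasoning

  χ-Span-isolated : ∀ {x w} → (∀ e → miss e ≡ x) → w ≢ x → ∀ v → Span (χ w) (χ w) (χ v)
  χ-Span-isolated {x} {w} all w≢x v with v ≟ x
  ... | yes refl = false , false , λ e → subst (λ y → χ y e ≡ false) (all e) (χ-at-miss e)
  ... | no v≢x   = true , false , λ e →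
    trans (full v≢x e) (sym (trans (xor-identityʳ (χ w e)) (full w≢x e)))
    where
    full : ∀ {y} → y ≢ x → ∀ e → χ y e ≡ true
    full y≢x e = χ-at-≢miss (λ y≡ → y≢x (trans y≡ (all e)))

  infix 4 _~_
  _~_ : Word (m G) → Word (m G) → Set
  _~_ = Rel G

  Γ-isGroup : IsGroup _~_ _·_ one inv
  Γ-isGroup = record
    { isMonoid = record
      { isSemigroup = record
        { isMagma = record
          { isEquivalence = record { refl = refl′ ; sym = sym′ ; trans = trans′ }
          ; ∙-cong        = ·-cong
          }
        ; assoc = assoc
        }
      ; identity = idˡ , idʳ
      }
    ; inverse = invˡ , invʳ
    ; ⁻¹-cong = inv-cong
    }

  Γ-group : Group 0ℓ 0ℓ
  Γ-group = record { isGroup = Γ-isGroup }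

  ≡⇒~ : ∀ {a b} → a ≡ b → a ~ b
  ≡⇒~ = Group.reflexive Γ-group

  gen-comm : ∀ e e′ → gen e · gen e′ ~ gen e′ · gen e
  gen-comm e e′ = comm e e′ v (≢miss⇒incident (avoid-≢ˡ (miss e) (miss e′)))
                              (≢miss⇒incident (avoid-≢ʳ (miss e) (miss e′)))
    where
    v : Fin 3
    v = avoid (miss e) (miss e′)

  centralises : ∀ {x} → (∀ e → x · gen e ~ gen e · x) → ∀ a → x · a ~ a · x
  centralises h (gen e) = h e
  centralises h one     = trans′ (idʳ _) (sym′ (idˡ _))
  centralises {x} h (a · b) = begin
    x · (a · b) ≈⟨ assoc x a b ⟨
    (x · a) · b ≈⟨ ·-cong (centralises h a) refl′ ⟩
    (a · x) · b ≈⟨ assoc a x b ⟩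
    a · (x · b) ≈⟨ ·-cong refl′ (centralises h b) ⟩
    a · (b · x) ≈⟨ assoc a b x ⟨
    (a · b) · x ∎
    where open import Relation.Binary.Reasoning.Setoid (Group.setoid Γ-group)
  centralises h (inv a) = commute-⁻¹ Γ-group (centralises h a)

  Γ-comm : ∀ a b → a · b ~ b · a
  Γ-comm a = centralises λ e → sym′ (centralises (gen-comm e) a)

  Γ-abelianGroup : AbelianGroup 0ℓ 0ℓ
  Γ-abelianGroup = record { isAbelianGroup = record { isGroup = Γ-isGroup ; comm = Γ-comm } }

  open import Algebra.Properties.CommutativeSemigroup
    (AbelianGroup.commutativeSemigroup Γ-abelianGroup) using (interchange)
  open import Algebra.Properties.Group Γ-group using (inverseˡ-unique)

  square : ∀ a → a · a ~ one
  square (gen e) = sq e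
  square one     = idˡ one
  square (a · b) = trans′ (interchange a b a b) (trans′ (·-cong (square a) (square b)) (idˡ one))
  square (inv a) = trans′ (·-cong (sym′ a≈a⁻¹) (sym′ a≈a⁻¹)) (square a)
    where
    a≈a⁻¹ : a ~ inv a
    a≈a⁻¹ = inverseˡ-unique a a (square a)

  inv-self : ∀ a → inv a ~ a
  inv-self a = sym′ (inverseˡ-unique a a (square a))

  gen? : Bool → Fin (m G) → Word (m G)
  gen? b e = if b then gen e else one

  gen?-xor : ∀ a b e → gen? (a xor b) e ~ gen? a e · gen? b e
  gen?-xor true  true  e = sym′ (sq e)
  gen?-xor true  false e = sym′ (idʳ (gen e))
  gen?-xor false b     e = sym′ (idˡ (gen? b e))

  ∏ : ∀ {k} → BV k → (Fin k → Fin (m G)) → Word (m G)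
  ∏ {zero}  z f = one
  ∏ {suc k} z f = if z zero then gen (f zero) · ∏ (z ∘ suc) (f ∘ suc) else ∏ (z ∘ suc) (f ∘ suc)

  ∏-cons : ∀ {k} (z : BV (suc k)) f → ∏ z f ~ gen? (z zero) (f zero) · ∏ (z ∘ suc) (f ∘ suc)
  ∏-cons z f with z zero
  ... | true  = refl′
  ... | false = sym′ (idˡ _)

  ∏-cong : ∀ {k} {z w : BV k} f → z ≗ w → ∏ z f ≡ ∏ w f
  ∏-cong {zero}  f eq = refl
  ∏-cong {suc k} {z} {w} f eq rewrite eq zero | ∏-cong (f ∘ suc) (eq ∘ suc) = refl

  ∏-0ᵛ : ∀ {k} f → ∏ {k} 0ᵛ f ≡ one
  ∏-0ᵛ {zero}  f = refl
  ∏-0ᵛ {suc k} f = ∏-0ᵛ (f ∘ suc)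

  ∏-δ : ∀ {k} f (i : Fin k) → ∏ (δ i) f ~ gen (f i)
  ∏-δ f zero    = trans′ (≡⇒~ (cong (gen (f zero) ·_) (∏-0ᵛ (f ∘ suc)))) (idʳ (gen (f zero)))
  ∏-δ f (suc i) = ∏-δ (f ∘ suc) i

  ∏-⊻ : ∀ {k} (z w : BV k) f → ∏ (z ⊻ w) f ~ ∏ z f · ∏ w f
  ∏-⊻ {zero}  z w f = sym′ (idˡ one)
  ∏-⊻ {suc k} z w f = begin
    ∏ (z ⊻ w) f
      ≈⟨ ∏-cons (z ⊻ w) f ⟩
    gen? (z zero xor w zero) e · ∏ (z′ ⊻ w′) f′
      ≈⟨ ·-cong (gen?-xor (z zero) (w zero) e) (∏-⊻ z′ w′ f′) ⟩
    (gen? (z zero) e · gen? (w zero) e) · (∏ z′ f′ · ∏ w′ f′)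
      ≈⟨ interchange _ _ _ _ ⟩
    (gen? (z zero) e · ∏ z′ f′) · (gen? (w zero) e · ∏ w′ f′)
      ≈⟨ ·-cong (∏-cons z f) (∏-cons w f) ⟨
    ∏ z f · ∏ w f
      ∎
    where
    open import Relation.Binary.Reasoning.Setoid (Group.setoid Γ-group)
    e : Fin (m G)
    e = f zero
    f′ : Fin k → Fin (m G)
    f′ = f ∘ suc
    z′ w′ : BV k
    z′ = z ∘ suc
    w′ = w ∘ suc

  parity : Word (m G) → BV (m G)
  parity (gen e) = δ e
  parity one     = 0ᵛ
  parity (a · b) = parity a ⊻ parity b
  parity (inv a) = parity a

  parity-∏ : ∀ {k} (z : BV k) f → parity (∏ z f) ≗ ∑ (λ i → z i ⊙ δ (f i))
  parity-∏ {zero}  z f j = refl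
  parity-∏ {suc k} z f j with z zero
  ... | true  = cong (δ (f zero) j xor_) (parity-∏ (z ∘ suc) (f ∘ suc) j)
  ... | false = parity-∏ (z ∘ suc) (f ∘ suc) j

  normal-form : ∀ a → a ~ ∏ (parity a) id
  normal-form (gen e) = sym′ (∏-δ id e)
  normal-form one     = ≡⇒~ (sym (∏-0ᵛ id))
  normal-form (a · b) =
    trans′ (·-cong (normal-form a) (normal-form b)) (sym′ (∏-⊻ (parity a) (parity b) id))
  normal-form (inv a) = trans′ (inv-self a) (normal-form a)

  prod-filter : ∀ {k} {P : Fin (m G) → Set} (P? : Decidable P) (f : Fin k → Fin (m G)) →
                prod (filter P? (tabulate f)) ≡ ∏ (λ i → does (P? (f i))) f
  prod-filter {zero}  P? f = refl
  prod-filter {suc k} P? f with does (P? (f zero))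
  ... | true  = cong (gen (f zero) ·_) (prod-filter P? (f ∘ suc))
  ... | false = prod-filter P? (f ∘ suc)

  χ-relator : ∀ v → ∏ (χ v) id ~ one
  χ-relator v = subst (_~ one) (prod-filter (incident? G v) id) (vertex v)

  parity-relator : ∀ v → parity (prod (Ev G v)) ≗ χ v
  parity-relator v j rewrite prod-filter (incident? G v) id =
    trans (parity-∏ (χ v) id j) (∑-basis (χ v) j)

  Span-relator : ∀ {v₁ v₂ z} → Span (χ v₁) (χ v₂) z → ∏ z id ~ one
  Span-relator {v₁} {v₂} {z} (α , β , z≗) = begin
    ∏ z id                                   ≡⟨ ∏-cong id z≗ ⟩
    ∏ (α ⊙ χ v₁ ⊻ β ⊙ χ v₂) id               ≈⟨ ∏-⊻ (α ⊙ χ v₁) (β ⊙ χ v₂) id ⟩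
    ∏ (α ⊙ χ v₁) id · ∏ (β ⊙ χ v₂) id        ≈⟨ ·-cong (scaled α v₁) (scaled β v₂) ⟩
    one · one                                ≈⟨ idˡ one ⟩
    one                                      ∎
    where
    open import Relation.Binary.Reasoning.Setoid (Group.setoid Γ-group)
    scaled : ∀ α v → ∏ (α ⊙ χ v) id ~ one
    scaled true  v = χ-relator v
    scaled false v = ≡⇒~ (∏-0ᵛ id)

  record VertexQuotient (k : ℕ) : Set where
    field
      L         : BV (m G) → BV k
      linear    : IsLinear L
      section   : Fin k → Fin (m G)
      L-section : ∀ i → L (δ (section i)) ≗ δ i
      v₁ v₂     : Fin 3
      kills-χ   : ∀ v → L (χ v) ≗ 0ᵛ
      ker⊆span  : ∀ z → L z ≗ 0ᵛ → Span (χ v₁) (χ v₂) z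

  module _ {k} (Q : VertexQuotient k) where
    open VertexQuotient Q
    open IsLinear linear

    L∘parity-cong : ∀ {a b} → a ~ b → L (parity a) ≗ L (parity b)
    L∘parity-cong refl′            = λ j → refl
    L∘parity-cong (sym′ r)         = λ j → sym (L∘parity-cong r j)
    L∘parity-cong (trans′ r s)     = λ j → trans (L∘parity-cong r j) (L∘parity-cong s j)
    L∘parity-cong (·-cong {a} {b} {c} {d} r s) = λ j → begin
      L (parity a ⊻ parity c) j       ≡⟨ ⊻-hom (parity a) (parity c) j ⟩
      L (parity a) j xor L (parity c) j ≡⟨ cong₂ _xor_ (L∘parity-cong r j) (L∘parity-cong s j) ⟩
      L (parity b) j xor L (parity d) j ≡⟨ ⊻-hom (parity b) (parity d) j ⟨
      L (parity b ⊻ parity d) j       ∎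
      where open ≡-Reasoning
    L∘parity-cong (inv-cong r)     = L∘parity-cong r
    L∘parity-cong (assoc a b c)    = ≗-cong λ i → xor-assoc (parity a i) (parity b i) (parity c i)
    L∘parity-cong (idˡ a)          = λ j → refl
    L∘parity-cong (idʳ a)          = ≗-cong λ i → xor-identityʳ (parity a i)
    L∘parity-cong (invˡ a)         = ≗-cong λ i → xor-same (parity a i)
    L∘parity-cong (invʳ a)         = ≗-cong λ i → xor-same (parity a i)
    L∘parity-cong (sq e)           = ≗-cong λ i → xor-same (δ e i)
    L∘parity-cong (comm e e′ _ _ _) = ≗-cong λ i → xor-comm (δ e i) (δ e′ i)
    L∘parity-cong (vertex v)       = λ j →
      trans (≗-cong (parity-relator v) j) (trans (kills-χ v j) (sym (0ᵛ-hom j)))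

    L∘parity-injective : ∀ a b → L (parity a) ≗ L (parity b) → a ~ b
    L∘parity-injective a b eq = begin
      a                        ≈⟨ normal-form a ⟩
      ∏ (parity a) id          ≡⟨ ∏-cong id (λ i → xor-cancelʳ refl) ⟩
      ∏ (d ⊻ parity b) id      ≈⟨ ∏-⊻ d (parity b) id ⟩
      ∏ d id · ∏ (parity b) id ≈⟨ ·-cong (Span-relator (ker⊆span d Ld≗0)) refl′ ⟩
      one · ∏ (parity b) id    ≈⟨ idˡ _ ⟩
      ∏ (parity b) id          ≈⟨ normal-form b ⟨
      b                        ∎
      where
      open import Relation.Binary.Reasoning.Setoid (Group.setoid Γ-group)
      d : BV (m G)
      d = parity a ⊻ parity b
      Ld≗0 : L d ≗ 0ᵛ
      Ld≗0 j = trans (⊻-hom (parity a) (parity b) j)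
                 (trans (cong (_xor L (parity b) j) (eq j)) (xor-same (L (parity b) j)))

    L∘parity-section : ∀ y → L (parity (∏ y section)) ≗ y
    L∘parity-section y j = begin
      L (parity (∏ y section)) j              ≡⟨ ≗-cong (parity-∏ y section) j ⟩
      L (∑ (λ i → y i ⊙ δ (section i))) j     ≡⟨ ∑-hom (λ i → y i ⊙ δ (section i)) j ⟩
      ∑ (λ i → L (y i ⊙ δ (section i))) j     ≡⟨ ⨁-cong (λ i → trans (⊙-hom (y i) _ j)
                                                                     (cong (y i ∧_) (L-section i j))) ⟩
      ∑ (λ i → y i ⊙ δ i) j                   ≡⟨ ∑-basis y j ⟩
      y j                                     ∎
      where open ≡-Reasoning

    quotient⇒Iso : Iso G k
    quotient⇒Iso = record
      { φ      = φ
      ; φ-cong = λ r → tabulate-cong (L∘parity-cong r)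
      ; φ-hom  = λ a b → trans (tabulate-cong (⊻-hom (parity a) (parity b))) (tabulate-xor _ _)
      ; φ-inj  = λ a b eq → L∘parity-injective a b λ j →
                   trans (sym (lookup∘tabulate _ j))
                         (trans (cong (λ v → lookup v j) eq) (lookup∘tabulate _ j))
      ; φ-surj = λ y → ∏ (lookup y) section ,
                   trans (tabulate-cong (L∘parity-section (lookup y))) (tabulate∘lookup y)
      }
      where
      φ : Word (m G) → Vec Bool k
      φ a = Vec.tabulate (L (parity a))

  isolated : ∀ {x y} → (∀ e → miss e ≡ x) → Reach G x y → x ≡ y
  isolated all here             = refl
  isolated all (step e x∈e _ _) = ⊥-elim (Equivalence.to incident⇔≢miss x∈e (sym (all e)))

  same-miss⇒disconnected : ∀ {x} → (∀ e → miss e ≡ x) → ¬ Connected G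
  same-miss⇒disconnected {x} all conn = avoid-≢ˡ x x (sym (isolated all (conn x (avoid x x))))

  distinct-misses⇒connected : ∀ {e₁ e₂} → miss e₁ ≢ miss e₂ → Connected G
  distinct-misses⇒connected {e₁} {e₂} a≢b u v = Reach-trans (to-hub u) (Reach-sym (to-hub v))
    where
    hub : Fin 3
    hub = avoid (miss e₁) (miss e₂)
    via : ∀ {u} e → u ≢ miss e → hub ≢ miss e → Reach G u hub
    via e u≢ hub≢ = step e (≢miss⇒incident u≢) (≢miss⇒incident hub≢) here
    to-hub : ∀ u → Reach G u hub
    to-hub u with u ≟ miss e₁
    ... | yes refl = via e₂ a≢b (avoid-≢ʳ (miss e₁) (miss e₂))
    ... | no u≢a   = via e₁ u≢a (avoid-≢ˡ (miss e₁) (miss e₂))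

  connected⇒miss-≢ : Connected G → ∀ x → ∃ λ e → miss e ≢ x
  connected⇒miss-≢ conn x =
    ¬∀⟶∃¬ (m G) (λ e → miss e ≡ x) (λ e → miss e ≟ x) (λ all → same-miss⇒disconnected all conn)

  connected⇒distinct-misses : Connected G → ∃₂ λ e₁ e₂ → miss e₁ ≢ miss e₂
  connected⇒distinct-misses conn =
    let e₁ , _   = connected⇒miss-≢ conn zero
        e₂ , b≢a = connected⇒miss-≢ conn (miss e₁)
    in  e₁ , e₂ , b≢a ∘ sym

  disconnected⇒same-miss : ¬ Connected G → ∀ e₀ e → miss e ≡ miss e₀
  disconnected⇒same-miss ¬conn e₀ e =
    decidable-stable (miss e ≟ miss e₀) (λ ne → ¬conn (distinct-misses⇒connected ne))

distinct-misses-iso : (G : Graph3) (e₁ e₂ : Fin (m G)) → miss G e₁ ≢ miss G e₂ → Iso G (m G ∸ 2)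
distinct-misses-iso (record { m = zero }) () _ _
distinct-misses-iso (record { m = suc zero }) zero zero a≢a = ⊥-elim (a≢a refl)
distinct-misses-iso G@(record { m = suc (suc n) }) e₁ e₂ a≢b = quotient⇒Iso G record
  { L         = E.eliminate₂
  ; linear    = E.eliminate₂-linear
  ; section   = punchIn e₁ ∘ punchIn p₂
  ; L-section = E.eliminate₂-δ
  ; v₁        = b
  ; v₂        = a
  ; kills-χ   = λ v → E.Span⊆ker pivot₁ pivot₂ (χ-Span G (a≢b ∘ sym) v)
  ; ker⊆span  = E.ker⊆Span pivot₁ pivot₂
  }
  where
  a b : Fin 3
  a = miss G e₁
  b = miss G e₂
  e₁≢e₂ : e₁ ≢ e₂
  e₁≢e₂ e₁≡e₂ = a≢b (cong (miss G) e₁≡e₂)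
  p₂ : Fin (suc n)
  p₂ = punchOut e₁≢e₂
  module E = Pivot₂ e₁ p₂ (χ G b) (χ G a)
  pivot₁ : χ G b e₁ ≡ true
  pivot₁ = χ-at-≢miss G (a≢b ∘ sym)
  pivot₂ : Pivot.eliminate e₁ (χ G b) (χ G a) p₂ ≡ true
  pivot₂ = subst (λ q → χ G a q xor (χ G a e₁ ∧ χ G b q) ≡ true) (sym (punchIn-punchOut e₁≢e₂))
             (cong₂ (λ x y → x xor (y ∧ χ G b e₂)) (χ-at-≢miss G a≢b) (χ-at-miss G e₁))

iso-connected : (G : Graph3) → Connected G → Iso G (m G ∸ 2)
iso-connected G conn =
  let e₁ , e₂ , a≢b = connected⇒distinct-misses G conn in distinct-misses-iso G e₁ e₂ a≢b

iso-disconnected : (G : Graph3) → ¬ Connected G → m G ≥ 1 → Iso G (m G ∸ 1)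
iso-disconnected (record { m = zero }) _ ()
iso-disconnected G@(record { m = suc n }) ¬conn _ = quotient⇒Iso G record
  { L         = E.eliminate
  ; linear    = E.eliminate-linear
  ; section   = suc
  ; L-section = E.eliminate-δ
  ; v₁        = w
  ; v₂        = w
  ; kills-χ   = λ v → IsLinear.Span⊆ker E.eliminate-linear
                        (E.eliminate-u pivot) (E.eliminate-u pivot) (χ-Span-isolated G same-miss w≢x v)
  ; ker⊆span  = λ z Lz≗0 → z zero , false , λ e →
                  trans (E.eliminate-ker pivot z Lz≗0 e) (sym (xor-identityʳ _))
  }
  where
  x w : Fin 3
  x = miss G zero
  w = avoid x x
  same-miss : ∀ e → miss G e ≡ x
  same-miss = disconnected⇒same-miss G ¬conn zero
  w≢x : w ≢ x
  w≢x = avoid-≢ˡ x x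
  module E = Pivot zero (χ G w)
  pivot : χ G w zero ≡ true
  pivot = χ-at-≢miss G w≢x

edgeless-trivial : (G : Graph3) → m G ≡ 0 → Trivial G
edgeless-trivial G@(record { m = zero }) _ = normal-form G
edgeless-trivial (record { m = suc _ }) ()

proposition5p12 : (G : Graph3) →
    (Connected G → Iso G (m G ∸ 2)) ×
    (¬ Connected G → m G ≥ 1 → Iso G (m G ∸ 1)) ×
    (m G ≡ 0 → Trivial G)
proposition5p12 G = iso-connected G , iso-disconnected G , edgeless-trivial G
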